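{- Let $l\ge 2$ be an integer, let $G$ be a graph, and let $v$ be a vertex of $G$. Assume that there is no vertex $u$ of $G$ such that $G_u-u$ contains no $l$-path (i.e., for every vertex $u$, the graph $G_u-u$ contains an $l$-path). Assume that $\beta(G,v)=2$, let $X=\{w_1,w_2\}$ be a $v$-hitting set of size $2$, and for $i=1,2$ let $C_i$ be the vertex set of the connected component of $G_v-v$ that contains $w_i$ (possibly $C_1=C_2$). If the graphs $G[C_1]$ and $G[C_2]$ do not contain $l$-paths, then there is exactly one connected component $C_0$ of $G_v-v$ such that $G[C_0]$ contains an $l$-path.
   Context: All graphs are finite, simple and undirected. An $l$-path is a simple path with exactly $l$ vertices; $V(P)$ denotes the vertex set of a path $P$. For a vertex set $S$, $G[S]$ is the induced subgraph on $S$ and $G-S=G[V(G)\setminus S]$; $G-u$ means $G-\{u\}$. For a vertex $u$, $C_u$ is the vertex set of the connected component of $G$ containing $u$, and $G_u=G[C_u]$. A $v$-path is an $l$-path containing $v$. A $v$-hitting set is a set $X\subseteq C_v\setminus\{v\}$ such that $X\cap V(P)\neq\emptyset$ for every $v$-path $P$. $\beta(G,v)$ denotes the minimum size of a $v$-hitting set in $G$. -}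

module Defs where

open import Data.Nat using (ℕ; _≤_)
open import Data.Bool using (Bool; T)
open import Data.Fin using (Fin)
open import Data.Fin.Subset using (Subset; _∈_; ∣_∣)
open import Data.List using (List; length)
open import Data.List.Relation.Unary.All using (All)
open import Data.List.Relation.Unary.Any using (Any)
open import Data.List.Relation.Unary.Linked using (Linked)
open import Data.List.Relation.Unary.Unique.Propositional using (Unique)
open import Data.Product using (Σ; ∃; _×_)
open import Relation.Binary.PropositionalEquality using (_≡_; _≢_)
open import Relation.Nullary using (¬_)

record Graph (n : ℕ) : Set where
  field
    adj   : Fin n → Fin n → Bool
    sym   : ∀ x y → adj x y ≡ adj y x
    irrefl : ∀ x → ¬ T (adj x x)

module _ {n : ℕ} (G : Graph n) where
  open Graph G

  Edge : Fin n → Fin n → Set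
  Edge x y = T (adj x y)

  VSet : Set₁
  VSet = Fin n → Set

  everything : VSet
  everything _ = Data.Unit.⊤
    where import Data.Unit

  data Reach (S : VSet) (x : Fin n) : Fin n → Set where
    here : S x → Reach S x x
    step : ∀ {y z} → Reach S x y → S z → Edge y z → Reach S x z

  Comp : VSet → Fin n → VSet
  Comp S u y = Reach S u y

  C : Fin n → VSet
  C u = Comp everything u

  CminusU : Fin n → VSet
  CminusU u x = C u x × x ≢ u

  record IsPath (l : ℕ) (S : VSet) (P : List (Fin n)) : Set where
    field
      len      : length P ≡ l
      distinct : Unique P
      inside   : All S P
      linked   : Linked Edge P

  HasPath : ℕ → VSet → Set
  HasPath l S = ∃ λ P → IsPath l S P

  IsVPath : ℕ → Fin n → List (Fin n) → Set
  IsVPath l v P = IsPath l everything P × Any (v ≡_) P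

  IsHitting : ℕ → Fin n → Subset n → Set
  IsHitting l v X =
    (∀ x → x ∈ X → CminusU v x) ×
    (∀ P → IsVPath l v P → Any (_∈ X) P)

  BetaIs : ℕ → Fin n → ℕ → Set
  BetaIs l v k =
    (∃ λ X → IsHitting l v X × ∣ X ∣ ≡ k) ×
    (∀ X → IsHitting l v X → k ≤ ∣ X ∣)

-- Every component D of G_v − v contains a neighbour d of v. If D contains an l-path P, walk
-- inside D from d to P, erase loops, and continue along the longer half of P: this is a path
-- from d with at least (l − 1)/2 vertices. Two such arms in different components, trimmed to
-- l − 1 vertices in total and joined through v, form a v-path on l vertices. It must meet the
-- hitting set X, yet it avoids v, and it avoids X inside both components because the
-- components containing the vertices of X have no l-path.
module Submission where

open import Data.Bool using () renaming (T to True)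
open import Data.Empty using (⊥-elim)
open import Data.Fin using (Fin) renaming (_≟_ to _≟ᶠ_)
open import Data.Fin.Subset as Subset using (Subset; ⁅_⁆; _∪_)
open import Data.Fin.Subset.Properties using (x∈⁅y⁆⇒x≡y; x∈p∪q⁻)
open import Data.List using (List; []; _∷_; _++_; _ʳ++_; [_]; reverse; take; length)
open import Data.List.Properties
  using (++-assoc; length-++; length-ʳ++; length-reverse; length-take; reverse-++; unfold-reverse)
open import Data.List.Membership.Propositional using (_∈_; _∉_; find; lose)
open import Data.List.Membership.Propositional.Properties using (∈-∃++; ∈-++⁻; ∈-++⁺ˡ; ∈-++⁺ʳ)
import Data.List.Membership.DecPropositional as DecMembership
open import Data.List.Relation.Binary.Disjoint.Propositional using (Disjoint)
open import Data.List.Relation.Unary.All as All using (All; []; _∷_)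
import Data.List.Relation.Unary.All.Properties as All
open import Data.List.Relation.Unary.Any as Any using (Any; here; there; any?)
import Data.List.Relation.Unary.Any.Properties as Any
open import Data.List.Relation.Unary.AllPairs as AllPairs using ([]; _∷_)
open import Data.List.Relation.Unary.Linked as Linked using (Linked; []; [-]; _∷_)
open import Data.List.Relation.Unary.Unique.Propositional using (Unique)
import Data.List.Relation.Unary.Unique.Propositional.Properties as Unique
open import Data.Nat using (ℕ; zero; suc; _+_; _∸_; _≤_; s≤s; s≤s⁻¹)
open import Data.Nat.Properties
  using (≤-total; ≤-trans; ≤-reflexive; +-monoˡ-≤; +-monoʳ-≤; +-mono-≤; +-suc; m≤n+m; n≤1+n; m≤n⇒m⊓n≡m;
         module ≤-Reasoning)
open import Data.Product using (∃; _×_; _,_; proj₁; proj₂)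
open import Data.Sum using (_⊎_; inj₁; inj₂)
open import Data.Unit using (tt)
open import Function using (_∘_; flip)
open import Function.Bundles using (_⇔_; mk⇔; Equivalence)
open import Relation.Binary.PropositionalEquality
  using (_≡_; _≢_; refl; sym; trans; cong; subst; module ≡-Reasoning)
open import Relation.Nullary using (¬_; yes; no)

open import Defs

module _ {A : Set} where

  All-ʳ++⁺ : ∀ {P : A → Set} xs {ys} → All P xs → All P ys → All P (xs ʳ++ ys)
  All-ʳ++⁺ []       []         pys = pys
  All-ʳ++⁺ (x ∷ xs) (px ∷ pxs) pys = All-ʳ++⁺ xs pxs (px ∷ pys)

  Unique-ʳ++⁺ : ∀ (xs : List A) {ys} → Unique xs → Unique ys → Disjoint xs ys → Unique (xs ʳ++ ys)
  Unique-ʳ++⁺ []       _            uys _     = uys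
  Unique-ʳ++⁺ (x ∷ xs) {ys} (x∉xs ∷ uxs) uys xs#ys = Unique-ʳ++⁺ xs uxs (x∉ys ∷ uys) xs#x∷ys
    where
      x∉ys : All (x ≢_) ys
      x∉ys = All.tabulate λ { x∈ys refl → xs#ys (here refl , x∈ys) }
      xs#x∷ys : Disjoint xs (x ∷ ys)
      xs#x∷ys (a∈xs , here refl)  = All.lookup x∉xs a∈xs refl
      xs#x∷ys (a∈xs , there a∈ys) = xs#ys (there a∈xs , a∈ys)

  Unique-++⁻ʳ : ∀ (xs : List A) {ys} → Unique (xs ++ ys) → Unique ys
  Unique-++⁻ʳ []       u       = u
  Unique-++⁻ʳ (_ ∷ xs) (_ ∷ u) = Unique-++⁻ʳ xs u

  module _ {R : A → A → Set} where

    Linked-ʳ++⁺ : ∀ {x} xs {ys} → Linked (flip R) (x ∷ xs) → Linked R (x ∷ ys) →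
                  Linked R (xs ʳ++ x ∷ ys)
    Linked-ʳ++⁺ []       _            rys = rys
    Linked-ʳ++⁺ (_ ∷ xs) (ryx ∷ rxs) rys = Linked-ʳ++⁺ xs rxs (ryx ∷ rys)

    Linked-++⁻ʳ : ∀ xs {ys} → Linked R (xs ++ ys) → Linked R ys
    Linked-++⁻ʳ []       r = r
    Linked-++⁻ʳ (_ ∷ xs) r = Linked-++⁻ʳ xs (Linked.tail r)

    Linked-take⁺ : ∀ j {xs} → Linked R xs → Linked R (take j xs)
    Linked-take⁺ zero          _                = []
    Linked-take⁺ (suc _)       []               = []
    Linked-take⁺ (suc zero)    {_ ∷ _} _        = [-]
    Linked-take⁺ (suc (suc _)) [-]              = [-]
    Linked-take⁺ (suc (suc j)) (r ∷ rs)         = r ∷ Linked-take⁺ (suc j) rs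

  reverse-++-∷ : ∀ xs (x : A) ys → reverse (xs ++ x ∷ ys) ≡ reverse ys ++ x ∷ reverse xs
  reverse-++-∷ xs x ys = begin
    reverse (xs ++ x ∷ ys)              ≡⟨ reverse-++ xs (x ∷ ys) ⟩
    reverse (x ∷ ys) ++ reverse xs      ≡⟨ cong (_++ reverse xs) (unfold-reverse x ys) ⟩
    (reverse ys ++ [ x ]) ++ reverse xs ≡⟨ ++-assoc (reverse ys) [ x ] (reverse xs) ⟩
    reverse ys ++ x ∷ reverse xs        ∎
    where open ≡-Reasoning

  length-++-∷ : ∀ xs (x : A) ys → length (xs ++ x ∷ ys) ≡ suc (length xs + length ys)
  length-++-∷ xs x ys = trans (length-++ xs) (+-suc (length xs) (length ys))

  length-take-∸ : ∀ k (xs ys : List A) → k ≤ length xs + length ys →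
                  length (take k xs) + length (take (k ∸ length xs) ys) ≡ k
  length-take-∸ zero    []       _  _  = refl
  length-take-∸ zero    (_ ∷ _)  _  _  = refl
  length-take-∸ (suc k) []       ys k≤ = trans (length-take (suc k) ys) (m≤n⇒m⊓n≡m k≤)
  length-take-∸ (suc k) (_ ∷ xs) ys k≤ = cong suc (length-take-∸ k xs ys (s≤s⁻¹ k≤))

k≤a+a⇒k≤b+b⇒k≤a+b : ∀ {k a b} → k ≤ a + a → k ≤ b + b → k ≤ a + b
k≤a+a⇒k≤b+b⇒k≤a+b {a = a} {b} k≤a+a k≤b+b with ≤-total a b
... | inj₁ a≤b = ≤-trans k≤a+a (+-monoʳ-≤ a a≤b)
... | inj₂ b≤a = ≤-trans k≤b+b (+-monoˡ-≤ b b≤a)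

module _ {n : ℕ} (G : Graph n) where

  open DecMembership (_≟ᶠ_ {n}) using (_∈?_)

  Edge-sym : ∀ {x y} → Edge G x y → Edge G y x
  Edge-sym {x} {y} = subst True (Graph.sym G x y)

  module _ {S : VSet G} where

    reach-target : ∀ {x y} → Reach G S x y → S y
    reach-target (here sx)     = sx
    reach-target (step _ sz _) = sz

    reach-trans : ∀ {x y z} → Reach G S x y → Reach G S y z → Reach G S x z
    reach-trans r (here _)       = r
    reach-trans r (step r′ sz e) = step (reach-trans r r′) sz e

    reach-sym : ∀ {x y} → Reach G S x y → Reach G S y x
    reach-sym (here sx)       = here sx
    reach-sym (step r sz e) = reach-trans (step (here sz) (reach-target r) (Edge-sym e)) (reach-sym r)

    Comp-⇔ : ∀ {u u′ a} → Comp G S u a → Comp G S u′ a → ∀ y → Comp G S u y ⇔ Comp G S u′ y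
    Comp-⇔ ua u′a y = mk⇔ (reach-trans (reach-trans u′a (reach-sym ua)))
                          (reach-trans (reach-trans ua (reach-sym u′a)))

    Comp-connected : ∀ {u x y} → Comp G S u x → Comp G S u y → Reach G (Comp G S u) x y
    Comp-connected {u} ux uy = lift ux (reach-trans (reach-sym ux) uy)
      where
        lift : ∀ {x y} → Reach G S u x → Reach G S x y → Reach G (Comp G S u) x y
        lift ux (here _)      = here ux
        lift ux (step r sz e) = step (lift ux r) (step (reach-trans ux r) sz e) e

    reach-along : ∀ {p x xs} → Reach G S p x → Linked (Edge G) (x ∷ xs) → All S xs →
                  All (Reach G S p) xs
    reach-along r _       []       = []
    reach-along r (e ∷ l) (s ∷ ss) = step r s e ∷ reach-along (step r s e) l ss

  IsPath-mono : ∀ {l} {S S′ : VSet G} {P} → (∀ {x} → S x → S′ x) → IsPath G l S P → IsPath G l S′ P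
  IsPath-mono S⊆S′ path = record
    { len = len ; distinct = distinct ; inside = All.map S⊆S′ inside ; linked = linked }
    where open IsPath path

  HasPath-mono : ∀ {l} {S S′ : VSet G} → (∀ {x} → S x → S′ x) → HasPath G l S → HasPath G l S′
  HasPath-mono S⊆S′ (P , path) = P , IsPath-mono S⊆S′ path

  HasPath⇒Comp : ∀ {k S} → HasPath G (suc k) S → ∃ λ p → S p × HasPath G (suc k) (Comp G S p)
  HasPath⇒Comp (p ∷ P , path) = p , sp , p ∷ P , record
    { len = len ; distinct = distinct ; linked = linked
    ; inside = here sp ∷ reach-along (here sp) linked (All.tail inside) }
    where
      open IsPath path
      sp = All.head inside

  SimplePath : VSet G → List (Fin n) → Set
  SimplePath S P = IsPath G (length P) S P

  module _ {S : VSet G} where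

    IsPath⇒SimplePath : ∀ {l P} → IsPath G l S P → SimplePath S P
    IsPath⇒SimplePath path = record { len = refl ; distinct = distinct ; inside = inside ; linked = linked }
      where open IsPath path

    SimplePath-∷ : ∀ {z y P} → S z → Edge G z y → z ∉ y ∷ P → SimplePath S (y ∷ P) →
                   SimplePath S (z ∷ y ∷ P)
    SimplePath-∷ sz e z∉ path = record
      { len = refl ; distinct = All.¬Any⇒All¬ _ z∉ ∷ distinct
      ; inside = sz ∷ inside ; linked = e ∷ linked }
      where open IsPath path

    SimplePath-++⁻ʳ : ∀ xs {ys} → SimplePath S (xs ++ ys) → SimplePath S ys
    SimplePath-++⁻ʳ xs {ys} path = record
      { len = refl ; distinct = Unique-++⁻ʳ xs {ys} distinct
      ; inside = All.++⁻ʳ xs {ys} inside ; linked = Linked-++⁻ʳ xs {ys} linked }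
      where open IsPath path

    SimplePath-take : ∀ j {P} → SimplePath S P → SimplePath S (take j P)
    SimplePath-take j path = record
      { len = refl ; distinct = Unique.take⁺ j distinct
      ; inside = All.take⁺ j inside ; linked = Linked-take⁺ j linked }
      where open IsPath path

    SimplePath-reverse : ∀ P → SimplePath S P → SimplePath S (reverse P)
    SimplePath-reverse P path = record
      { len = refl ; distinct = Unique-ʳ++⁺ P {[]} distinct [] λ ()
      ; inside = All-ʳ++⁺ P {[]} inside [] ; linked = reversed P linked }
      where
        open IsPath path
        reversed : ∀ P → Linked (Edge G) P → Linked (Edge G) (reverse P)
        reversed []      _ = []
        reversed (_ ∷ P) l = Linked-ʳ++⁺ P (Linked.map Edge-sym l) [-]

    -- R records the loop-erased part of a walk from z back to the path P.
    record LongPathFrom (P : List (Fin n)) (z : Fin n) : Set where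
      field
        R T  : List (Fin n)
        path : SimplePath S (z ∷ R ++ T)
        T⊆P  : ∀ {x} → x ∈ T → x ∈ P
        long : length P ≤ suc (length T + length T)

    half-of-path : ∀ {l P p} → IsPath G l S P → p ∈ P → LongPathFrom P p
    half-of-path {P = P} path p∈P with ∈-∃++ p∈P
    ... | A , B , refl with ≤-total (length A) (length B)
    ... | inj₁ A≤B = record
      { R = [] ; T = B ; path = SimplePath-++⁻ʳ A (IsPath⇒SimplePath path)
      ; T⊆P = ∈-++⁺ʳ A ∘ there
      ; long = ≤-trans (≤-reflexive (length-++-∷ A _ B)) (s≤s (+-monoˡ-≤ (length B) A≤B)) }
    ... | inj₂ B≤A = record
      { R = [] ; T = reverse A
      ; path = SimplePath-++⁻ʳ (reverse B)
          (subst (SimplePath S) (reverse-++-∷ A _ B) (SimplePath-reverse P (IsPath⇒SimplePath path)))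
      ; T⊆P = ∈-++⁺ˡ ∘ Any.reverse⁻ {xs = A} ; long = long }
      where
        open ≤-Reasoning
        long : length P ≤ suc (length (reverse A) + length (reverse A))
        long = begin
          length P                                      ≡⟨ length-++-∷ A _ B ⟩
          suc (length A + length B)                     ≤⟨ s≤s (+-monoʳ-≤ (length A) B≤A) ⟩
          suc (length A + length A)                     ≡⟨ cong (λ a → suc (a + a)) (length-reverse A) ⟨
          suc (length (reverse A) + length (reverse A)) ∎

    LongPathFrom-step : ∀ {P y z} → LongPathFrom P y → S z → Edge G y z → z ∉ P → LongPathFrom P z
    LongPathFrom-step {y = y} {z} lp sz e z∉P with z ∈? y ∷ LongPathFrom.R lp
    ... | yes z∈yR with ∈-∃++ z∈yR
    ...   | R₁ , R₂ , yR≡ = record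
      { R = R₂ ; T = T ; path = SimplePath-++⁻ʳ R₁ (subst (SimplePath S) split path)
      ; T⊆P = T⊆P ; long = long }
      where
        open LongPathFrom lp
        split : y ∷ R ++ T ≡ R₁ ++ z ∷ R₂ ++ T
        split = trans (cong (_++ T) yR≡) (++-assoc R₁ (z ∷ R₂) T)
    LongPathFrom-step {y = y} {z} lp sz e z∉P | no z∉yR =
      record { R = y ∷ R ; T = T ; path = SimplePath-∷ sz (Edge-sym e) z∉yRT path
             ; T⊆P = T⊆P ; long = long }
      where
        open LongPathFrom lp
        z∉yRT : z ∉ y ∷ R ++ T
        z∉yRT z∈ with ∈-++⁻ (y ∷ R) z∈
        ... | inj₁ z∈yR = z∉yR z∈yR
        ... | inj₂ z∈T  = z∉P (T⊆P z∈T)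

    reach⇒LongPathFrom : ∀ {l P p z} → IsPath G l S P → p ∈ P → Reach G S p z → LongPathFrom P z
    reach⇒LongPathFrom path p∈P (here _) = half-of-path path p∈P
    reach⇒LongPathFrom {P = P} path p∈P (step {z = z} r sz e) with z ∈? P
    ... | yes z∈P = half-of-path path z∈P
    ... | no z∉P  = LongPathFrom-step (reach⇒LongPathFrom path p∈P r) sz e z∉P

module _ {n : ℕ} (G : Graph n) (v : Fin n) where

  open DecMembership (_≟ᶠ_ {n}) using (_∈?_)

  S : VSet G
  S = CminusU G v

  D : Fin n → VSet G
  D = Comp G S

  D⇒≢v : ∀ {u x} → D u x → x ≢ v
  D⇒≢v = proj₂ ∘ reach-target G

  leave-v : ∀ {z} → Reach G (everything G) v z → z ≡ v ⊎ ∃ λ d → Edge G v d × Reach G S d z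
  leave-v (here _) = inj₁ refl
  leave-v (step {z = z} r t e) with z ≟ᶠ v | leave-v r
  ... | yes z≡v | _                  = inj₁ z≡v
  ... | no z≢v  | inj₁ refl          = inj₂ (z , e , here (step r t e , z≢v))
  ... | no z≢v  | inj₂ (d , vd , dy) = inj₂ (d , vd , step dy (step r t e , z≢v) e)

  neighbour-in-Comp : ∀ {u} → S u → ∃ λ d → Edge G v d × D u d
  neighbour-in-Comp (vu , u≢v) with leave-v vu
  ... | inj₁ u≡v           = ⊥-elim (u≢v u≡v)
  ... | inj₂ (d , vd , du) = d , vd , reach-sym G du

  Arm : VSet G → List (Fin n) → Set
  Arm S′ A = SimplePath G (everything G) (v ∷ A) × All S′ A

  Arm-take : ∀ j {S′ A} → Arm S′ A → Arm S′ (take j A)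
  Arm-take j (path , inside) = SimplePath-take G (suc j) path , All.take⁺ j inside

  Arm-join : ∀ {S₁ S₂ A₁ A₂} → Arm S₁ A₁ → Arm S₂ A₂ → Disjoint A₁ A₂ →
             IsVPath G (suc (length A₁ + length A₂)) v (A₁ ʳ++ v ∷ A₂)
  Arm-join {A₁ = A₁} {A₂} (path₁ , _) (path₂ , _) A₁#A₂ =
    joined , Any.reverseAcc⁺ (v ∷ A₂) A₁ (inj₁ (here refl))
    where
      A₁#vA₂ : Disjoint A₁ (v ∷ A₂)
      A₁#vA₂ (a∈A₁ , here refl)  = All.lookup (AllPairs.head (IsPath.distinct path₁)) a∈A₁ refl
      A₁#vA₂ (a∈A₁ , there a∈A₂) = A₁#A₂ (a∈A₁ , a∈A₂)
      joined : IsPath G (suc (length A₁ + length A₂)) (everything G) (A₁ ʳ++ v ∷ A₂)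
      joined = record
        { len      = trans (length-ʳ++ A₁) (+-suc (length A₁) (length A₂))
        ; distinct = Unique-ʳ++⁺ A₁ {v ∷ A₂} (AllPairs.tail (IsPath.distinct path₁))
                                             (IsPath.distinct path₂) A₁#vA₂
        ; inside   = All.tabulate (λ _ → tt)
        ; linked   = Linked-ʳ++⁺ A₁ (Linked.map (Edge-sym G) (IsPath.linked path₁))
                                    (IsPath.linked path₂) }

  long-arm : ∀ {k u} → S u → HasPath G (suc k) (D u) →
             ∃ λ A → Arm (D u) A × suc k ≤ suc (length A + length A)
  long-arm {u = u} su (p ∷ P , isPath) with neighbour-in-Comp su
  ... | d , vd , ud =
    d ∷ R ++ T , (SimplePath-∷ G tt vd v∉ (IsPath-mono G _ path) , IsPath.inside path) , bound
    where
      p⇝d : Reach G (D u) p d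
      p⇝d = Comp-connected G (All.head (IsPath.inside isPath)) ud
      open LongPathFrom (reach⇒LongPathFrom G isPath (here refl) p⇝d)
      v∉ : v ∉ d ∷ R ++ T
      v∉ v∈ = D⇒≢v (All.lookup (IsPath.inside path) v∈) refl
      T≤A : length T ≤ length (d ∷ R ++ T)
      T≤A = ≤-trans (m≤n+m (length T) (length R)) (≤-trans (≤-reflexive (sym (length-++ R))) (n≤1+n _))
      bound : suc _ ≤ suc (length (d ∷ R ++ T) + length (d ∷ R ++ T))
      bound = ≤-trans (≤-reflexive (sym (IsPath.len isPath))) (≤-trans long (s≤s (+-mono-≤ T≤A T≤A)))

  module _ {k : ℕ} {X : Subset n} (hit : IsHitting G (suc k) v X)
           (pathless : ∀ {x} → x Subset.∈ X → ¬ HasPath G (suc k) (D x)) where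

    X-avoids-Comp-with-path : ∀ {u x} → HasPath G (suc k) (D u) → D u x → ¬ x Subset.∈ X
    X-avoids-Comp-with-path hp ux x∈X =
      pathless x∈X (HasPath-mono G (λ {y} → Equivalence.to (Comp-⇔ G ux (here (reach-target G ux)) y)) hp)

    join-avoids-X : ∀ {u u′ A₁ A₂} → Arm (D u) A₁ → Arm (D u′) A₂ →
                    HasPath G (suc k) (D u) → HasPath G (suc k) (D u′) →
                    ¬ Any (Subset._∈ X) (A₁ ʳ++ v ∷ A₂)
    join-avoids-X {A₁ = A₁} {A₂} (_ , in₁) (_ , in₂) hp hp′ hits with find hits
    ... | x , x∈F , x∈X with Any.reverseAcc⁻ (v ∷ A₂) A₁ x∈F
    ... | inj₁ (here x≡v)   = proj₂ (proj₁ hit x x∈X) x≡v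
    ... | inj₁ (there x∈A₂) = X-avoids-Comp-with-path hp′ (All.lookup in₂ x∈A₂) x∈X
    ... | inj₂ x∈A₁         = X-avoids-Comp-with-path hp (All.lookup in₁ x∈A₁) x∈X

    arms-meet : ∀ {u u′ A₁ A₂} → Arm (D u) A₁ → Arm (D u′) A₂ → suc (length A₁ + length A₂) ≡ suc k →
                HasPath G (suc k) (D u) → HasPath G (suc k) (D u′) → ∀ y → D u y ⇔ D u′ y
    arms-meet {A₁ = A₁} {A₂} arm₁ arm₂ len hp hp′ with any? (_∈? A₂) A₁
    ... | yes common with find common
    ...   | a , a∈A₁ , a∈A₂ = Comp-⇔ G (All.lookup (proj₂ arm₁) a∈A₁) (All.lookup (proj₂ arm₂) a∈A₂)
    arms-meet {A₁ = A₁} {A₂} arm₁ arm₂ len hp hp′ | no disjoint =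
      ⊥-elim (join-avoids-X arm₁ arm₂ hp hp′ (proj₂ hit _ v-path))
      where
        v-path : IsVPath G (suc k) v (A₁ ʳ++ v ∷ A₂)
        v-path = subst (λ l → IsVPath G l v (A₁ ʳ++ v ∷ A₂)) len
                   (Arm-join arm₁ arm₂ λ (a∈A₁ , a∈A₂) → disjoint (lose a∈A₁ a∈A₂))

    Comp-with-path-unique : ∀ {u u′} → S u → S u′ →
                            HasPath G (suc k) (D u) → HasPath G (suc k) (D u′) →
                            ∀ y → D u y ⇔ D u′ y
    Comp-with-path-unique su su′ hp hp′ with long-arm su hp | long-arm su′ hp′
    ... | A₁ , arm₁ , b₁ | A₂ , arm₂ , b₂ =
      arms-meet (Arm-take k arm₁) (Arm-take (k ∸ length A₁) arm₂) (cong suc trimmed) hp hp′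
      where
        trimmed : length (take k A₁) + length (take (k ∸ length A₁) A₂) ≡ k
        trimmed = length-take-∸ k A₁ A₂
                    (k≤a+a⇒k≤b+b⇒k≤a+b {k} {length A₁} {length A₂} (s≤s⁻¹ b₁) (s≤s⁻¹ b₂))

lemma2 : (l : ℕ) → 2 ≤ l → {n : ℕ} → (G : Graph n) → (v : Fin n) →
    (∀ u → HasPath G l (CminusU G u)) →
    BetaIs G l v 2 →
    (w₁ w₂ : Fin n) → w₁ ≢ w₂ →
    IsHitting G l v (⁅ w₁ ⁆ ∪ ⁅ w₂ ⁆) →
    ¬ HasPath G l (Comp G (CminusU G v) w₁) →
    ¬ HasPath G l (Comp G (CminusU G v) w₂) →
    ∃ λ u₀ → CminusU G v u₀ × HasPath G l (Comp G (CminusU G v) u₀) ×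
      (∀ u → CminusU G v u → HasPath G l (Comp G (CminusU G v) u) →
        ∀ y → Comp G (CminusU G v) u y ⇔ Comp G (CminusU G v) u₀ y)
lemma2 (suc k) (s≤s _) G v paths _ w₁ w₂ _ hit no₁ no₂ with HasPath⇒Comp G (paths v)
... | u₀ , su₀ , hp₀ = u₀ , su₀ , hp₀ , λ u su hp → Comp-with-path-unique G v hit pathless su su₀ hp hp₀
  where
    pathless : ∀ {x} → x Subset.∈ ⁅ w₁ ⁆ ∪ ⁅ w₂ ⁆ → ¬ HasPath G (suc k) (Comp G (CminusU G v) x)
    pathless x∈X with x∈p∪q⁻ ⁅ w₁ ⁆ ⁅ w₂ ⁆ x∈X
    ... | inj₁ x∈w₁ rewrite x∈⁅y⁆⇒x≡y w₁ x∈w₁ = no₁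
    ... | inj₂ x∈w₂ rewrite x∈⁅y⁆⇒x≡y w₂ x∈w₂ = no₂
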